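{- Let $H$ be a $3$-edge-connected graph, and let $Y$ be an inclusion-minimal subset of $V(H)$ such that $\delta(Y)$ is a nontrivial edge-cut of size $3$ in $H$. Then for every edge $e$ of $H[Y]$, the graph $H\setminus e$ is internally $3$-edge-connected.
   Context: Graphs are finite, undirected, may have parallel edges. For $X\subseteq V(H)$, $\delta(X)$ is the set of edges with exactly one end in $X$. An edge-cut $\delta(X)$ ($\emptyset\ne X\subsetneq V(H)$) is trivial if $|X|=1$ or $|V(H)\setminus X|=1$, and nontrivial otherwise. $H$ is $3$-edge-connected if $|\delta(X)|\ge 3$ for all $\emptyset\ne X\subsetneq V(H)$. A graph is internally $3$-edge-connected if every edge-cut with fewer than $3$ edges is trivial (the set of edges incident with a single vertex). $H[Y]$ is the subgraph induced by $Y$. -}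

module Defs where

open import Data.Nat using (ℕ; zero; suc; _≤_; _<_)
open import Data.Fin using (Fin; punchIn)
open import Data.Fin.Subset using (Subset; _∈_; _⊂_; ∣_∣; ∁; Nonempty)
open import Data.Bool using (Bool; true; false; _xor_)
open import Data.Vec using (lookup; tabulate)
open import Data.Product using (_×_; proj₁; proj₂; _,_)
open import Data.Sum using (_⊎_)
open import Relation.Binary.PropositionalEquality using (_≡_)
open import Relation.Nullary using (¬_)

-- A finite multigraph: vertices Fin n, edges Fin m, each edge has two ends
-- (parallel edges allowed; loops are allowed too and never lie in a cut).
record Graph : Set where
  constructor graph
  field
    n    : ℕ
    m    : ℕ
    ends : Fin m → Fin n × Fin n
open Graph public

V : Graph → Set
V H = Fin (n H)

E : Graph → Set
E H = Fin (m H)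

VSet : Graph → Set
VSet H = Subset (n H)

δ : (H : Graph) → VSet H → Subset (m H)
δ H X = tabulate λ e → lookup X (proj₁ (ends H e)) xor lookup X (proj₂ (ends H e))

IsCutSide : (H : Graph) → VSet H → Set
IsCutSide H X = Nonempty X × Nonempty (∁ X)

TrivialCut : (H : Graph) → VSet H → Set
TrivialCut H X = ∣ X ∣ ≡ 1 ⊎ ∣ ∁ X ∣ ≡ 1

NontrivialCut : (H : Graph) → VSet H → Set
NontrivialCut H X = IsCutSide H X × 2 ≤ ∣ X ∣ × 2 ≤ ∣ ∁ X ∣

ThreeEdgeConnected : Graph → Set
ThreeEdgeConnected H = ∀ (X : VSet H) → IsCutSide H X → 3 ≤ ∣ δ H X ∣

InternallyThreeEdgeConnected : Graph → Set
InternallyThreeEdgeConnected H =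
  ∀ (X : VSet H) → IsCutSide H X → ∣ δ H X ∣ < 3 → TrivialCut H X

NontrivialThreeCut : (H : Graph) → VSet H → Set
NontrivialThreeCut H Y = NontrivialCut H Y × ∣ δ H Y ∣ ≡ 3

InclusionMinimal : (H : Graph) → (VSet H → Set) → VSet H → Set
InclusionMinimal H P Y = P Y × (∀ (Z : VSet H) → Z ⊂ Y → ¬ P Z)

EdgeOfInduced : (H : Graph) → VSet H → E H → Set
EdgeOfInduced H Y e = proj₁ (ends H e) ∈ Y × proj₂ (ends H e) ∈ Y

deleteEdge : (H : Graph) → E H → Graph
deleteEdge (graph n (suc k) ends) e = graph n k (λ f → ends (punchIn e f))

module Submission where

-- Take a cut side X of H∖e with at most two edges.  As |δ_H(X)| ≥ 3 and the
-- deletion of e lowers it by at most one, e crosses X and |δ_H(X)| = 3.  If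
-- δ(X) were nontrivial, X and Y would cross (the ends of e lie in Y, one in
-- X and one outside), which is impossible by uncrossing: if X ⊆ Y or ∁X ⊆ Y
-- that set is a smaller nontrivial 3-cut inside Y; otherwise submodularity
-- and posimodularity of |δ| force |δ(X ∩ Y)| = |δ(Y ─ X)| = 3, whereas
-- |δ(X ∩ Y)| + |δ(Y ─ X)| = |δ(Y)| + 2·#(edges of H[Y] crossing X) is odd.

open import Defs
import Algebra.Lattice.Properties.BooleanAlgebra as BooleanAlgebraProperties
open import Data.Bool using (Bool; true; false; not; _∧_; _∨_; _xor_; T)
open import Data.Bool.Properties using (T-∧; ∧-zeroʳ; ∧-identityʳ; not-involutive; not-distribˡ-xor; not-distribʳ-xor)
open import Data.Fin using (Fin; zero; suc)
open import Data.Fin.Properties using (any?)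
open import Data.Fin.Subset using (Subset; _∈_; _∉_; _⊆_; ∣_∣; ∁; Nonempty; _∩_; _∪_; _─_; ⁅_⁆)
open import Data.Fin.Subset.Properties using (_∈?_; ∣⁅x⁆∣≡1; x∈⁅y⁆⇒x≡y; p⊆q⇒∣p∣≤∣q∣; x∈p⇒x∉∁p; x∈∁p⇒x∉p; x∉p⇒x∈∁p; x∈p∩q⁺; x∈p∩q⁻; x∈p∪q⁺; x∈p∪q⁻; x∈p∧x∉q⇒x∈p─q; p─q⊆p; ∪-∩-booleanAlgebra)
open import Data.Nat using (ℕ; zero; suc; _+_; _≤_; _<_; _≤ᵇ_; _≡ᵇ_; _≟_; z≤n)
import Data.Nat.Properties
open Data.Nat.Properties using (suc-injective; +-0-commutativeMonoid; +-mono-≤; +-cancelˡ-≡; +-cancelʳ-≤; +-monoʳ-≤; +-suc; ≤-trans; ≤-antisym; ≤-reflexive; <⇒≱; ≤∧≢⇒<; ≤ᵇ⇒≤; ≡ᵇ⇒≡)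
open import Data.Product using (_×_; _,_; proj₁; proj₂; ∃)
open import Data.Sum using (_⊎_; inj₁; inj₂; [_,_])
open import Data.Empty using (⊥; ⊥-elim)
open import Data.Vec using (_∷_; []; lookup)
open import Data.Vec.Properties using (lookup∘tabulate; lookup-map; lookup-zipWith; []=⇒lookup; lookup⇒[]=)
open import Function using (_∘_)
open import Function.Bundles using (Equivalence)
open import Relation.Binary.PropositionalEquality using (_≡_; _≢_; refl; sym; trans; cong; cong₂; subst; subst₂; module ≡-Reasoning)
open import Relation.Nullary using (yes; no)
open import Relation.Nullary.Decidable using (decidable-stable; _×-dec_; ¬?)
open import Algebra.Properties.CommutativeMonoid.Sum +-0-commutativeMonoid using (sum; sum-remove; ∑-distrib-+; sum-cong-≗)

⟦_⟧ : Bool → ℕ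
⟦ true ⟧ = 1
⟦ false ⟧ = 0

sum-mono-≤ : ∀ {k} {f g : Fin k → ℕ} → (∀ i → f i ≤ g i) → sum f ≤ sum g
sum-mono-≤ {zero} f≤g = z≤n
sum-mono-≤ {suc k} f≤g = +-mono-≤ (f≤g zero) (sum-mono-≤ (f≤g ∘ suc))

sum-+-mono-≤ : ∀ {k} {f g h l : Fin k → ℕ} → (∀ i → f i + g i ≤ h i + l i) →
  sum f + sum g ≤ sum h + sum l
sum-+-mono-≤ {f = f} {g} {h} {l} le =
  subst₂ _≤_ (∑-distrib-+ f g) (∑-distrib-+ h l) (sum-mono-≤ le)

∣p∣≡∑ : ∀ {k} (p : Subset k) → ∣ p ∣ ≡ sum (λ i → ⟦ lookup p i ⟧)
∣p∣≡∑ [] = refl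
∣p∣≡∑ (true ∷ p) = cong suc (∣p∣≡∑ p)
∣p∣≡∑ (false ∷ p) = ∣p∣≡∑ p

2≤∣p∣ : ∀ {k} {p : Subset k} → Nonempty p → ∣ p ∣ ≢ 1 → 2 ≤ ∣ p ∣
2≤∣p∣ {p = p} (x , x∈p) ∣p∣≢1 = ≤∧≢⇒< 1≤∣p∣ (∣p∣≢1 ∘ sym)
  where
  ⁅x⁆⊆p : ⁅ x ⁆ ⊆ p
  ⁅x⁆⊆p y∈⁅x⁆ = subst (_∈ p) (sym (x∈⁅y⁆⇒x≡y x y∈⁅x⁆)) x∈p
  1≤∣p∣ : 1 ≤ ∣ p ∣
  1≤∣p∣ = subst (_≤ ∣ p ∣) (∣⁅x⁆∣≡1 x) (p⊆q⇒∣p∣≤∣q∣ ⁅x⁆⊆p)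

lookup-─ : ∀ {k} (p q : Subset k) (i : Fin k) → lookup (p ─ q) i ≡ lookup p i ∧ not (lookup q i)
lookup-─ (x ∷ p) (true ∷ q) zero = sym (∧-zeroʳ x)
lookup-─ (x ∷ p) (false ∷ q) zero = sym (∧-identityʳ x)
lookup-─ (x ∷ p) (y ∷ q) (suc i) = lookup-─ p q i

∉-lookup : ∀ {k} {p : Subset k} {i : Fin k} → lookup p i ≡ false → i ∉ p
∉-lookup p[i]≡false i∈p with trans (sym ([]=⇒lookup i∈p)) p[i]≡false
... | ()

∁-involutive : ∀ {k} (p : Subset k) → ∁ (∁ p) ≡ p
∁-involutive {k} = BooleanAlgebraProperties.¬-involutive (∪-∩-booleanAlgebra k)

⊆-or-counterexample : ∀ {k} (p q : Subset k) → p ⊆ q ⊎ ∃ λ v → v ∈ p × v ∉ q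
⊆-or-counterexample p q with any? (λ v → v ∈? p ×-dec ¬? (v ∈? q))
... | yes counterexample = inj₂ counterexample
... | no none = inj₁ λ {v} v∈p → decidable-stable (v ∈? q) (λ v∉q → none (v , v∈p , v∉q))

crossing : Bool → Bool → ℕ
crossing a b = ⟦ a xor b ⟧

Bool⁴ : Set → Set
Bool⁴ A = Bool → Bool → Bool → Bool → A

every : (Bool → Bool) → Bool
every g = g true ∧ g false

every-sound : (g : Bool → Bool) → T (every g) → ∀ b → T (g b)
every-sound g ok true = proj₁ (Equivalence.to T-∧ ok)
every-sound g ok false = proj₂ (Equivalence.to T-∧ ok)

-- A four-variable Boolean formula is a tautology if its whole truth table is
-- true; such a fact is then proved by evaluation.
Tautology : Bool⁴ Bool → Bool
Tautology f = every λ a → every λ b → every λ c → every λ d → f a b c d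

tautology : (f : Bool⁴ Bool) → T (Tautology f) → ∀ a b c d → T (f a b c d)
tautology f ok a b c d =
  every-sound (f a b c) (every-sound (λ c → every (f a b c))
    (every-sound (λ b → every λ c → every (f a b c))
      (every-sound (λ a → every λ b → every λ c → every (f a b c)) ok a) b) c) d

by-truth-table-≤ : (l r : Bool⁴ ℕ) → T (Tautology λ a b c d → l a b c d ≤ᵇ r a b c d) →
  ∀ a b c d → l a b c d ≤ r a b c d
by-truth-table-≤ l r ok a b c d =
  ≤ᵇ⇒≤ _ _ (tautology (λ a b c d → l a b c d ≤ᵇ r a b c d) ok a b c d)

by-truth-table-≡ : (l r : Bool⁴ ℕ) → T (Tautology λ a b c d → l a b c d ≡ᵇ r a b c d) →
  ∀ a b c d → l a b c d ≡ r a b c d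
by-truth-table-≡ l r ok a b c d =
  ≡ᵇ⇒≡ _ _ (tautology (λ a b c d → l a b c d ≡ᵇ r a b c d) ok a b c d)

crossing-submodular : ∀ x₁ x₂ y₁ y₂ →
  crossing (x₁ ∧ y₁) (x₂ ∧ y₂) + crossing (x₁ ∨ y₁) (x₂ ∨ y₂) ≤ crossing x₁ x₂ + crossing y₁ y₂
crossing-submodular = by-truth-table-≤ _ _ _

crossing-posimodular : ∀ x₁ x₂ y₁ y₂ →
  crossing (y₁ ∧ not x₁) (y₂ ∧ not x₂) + crossing (x₁ ∧ not y₁) (x₂ ∧ not y₂) ≤ crossing x₁ x₂ + crossing y₁ y₂
crossing-posimodular = by-truth-table-≤ _ _ _

crossing-split : ∀ x₁ x₂ y₁ y₂ →
  crossing (x₁ ∧ y₁) (x₂ ∧ y₂) + crossing (y₁ ∧ not x₁) (y₂ ∧ not x₂)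
    ≡ crossing y₁ y₂ + (⟦ (y₁ ∧ y₂) ∧ (x₁ xor x₂) ⟧ + ⟦ (y₁ ∧ y₂) ∧ (x₁ xor x₂) ⟧)
crossing-split = by-truth-table-≡ _ _ _

crossing-complement : ∀ a b → crossing (not a) (not b) ≡ crossing a b
crossing-complement a b = cong ⟦_⟧ (begin
  not a xor not b     ≡⟨ not-distribˡ-xor a (not b) ⟨
  not (a xor not b)   ≡⟨ cong not (not-distribʳ-xor a b) ⟨
  not (not (a xor b)) ≡⟨ not-involutive (a xor b) ⟩
  a xor b             ∎)
  where open ≡-Reasoning

xor-true : ∀ {a b} → a xor b ≡ true → (a ≡ true × b ≡ false) ⊎ (a ≡ false × b ≡ true)
xor-true {true} {true} ()
xor-true {true} {false} _ = inj₁ (refl , refl)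
xor-true {false} {true} _ = inj₂ (refl , refl)
xor-true {false} {false} ()

module _ (H : Graph) where

  end₁ end₂ : E H → V H
  end₁ e = proj₁ (ends H e)
  end₂ e = proj₂ (ends H e)

  crosses : VSet H → E H → Bool
  crosses X e = lookup X (end₁ e) xor lookup X (end₂ e)

  χ : VSet H → E H → ℕ
  χ X e = ⟦ crosses X e ⟧

  χ-inside : VSet H → VSet H → E H → ℕ
  χ-inside X Y e = ⟦ (lookup Y (end₁ e) ∧ lookup Y (end₂ e)) ∧ crosses X e ⟧

  ∣δ∣≡∑χ : ∀ X → ∣ δ H X ∣ ≡ sum (χ X)
  ∣δ∣≡∑χ X = trans (∣p∣≡∑ (δ H X)) (sum-cong-≗ λ e → cong ⟦_⟧ (lookup∘tabulate (crosses X) e))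

  χ-pointwise : ∀ Z A B (f : Bool → Bool → Bool) →
    (∀ v → lookup Z v ≡ f (lookup A v) (lookup B v)) → ∀ e →
    χ Z e ≡ crossing (f (lookup A (end₁ e)) (lookup B (end₁ e))) (f (lookup A (end₂ e)) (lookup B (end₂ e)))
  χ-pointwise Z A B f Z≗ e = cong₂ crossing (Z≗ (end₁ e)) (Z≗ (end₂ e))

  χ-∩ : ∀ X Y e → χ (X ∩ Y) e ≡ crossing (lookup X (end₁ e) ∧ lookup Y (end₁ e)) (lookup X (end₂ e) ∧ lookup Y (end₂ e))
  χ-∩ X Y = χ-pointwise (X ∩ Y) X Y _∧_ λ v → lookup-zipWith _∧_ v X Y

  χ-∪ : ∀ X Y e → χ (X ∪ Y) e ≡ crossing (lookup X (end₁ e) ∨ lookup Y (end₁ e)) (lookup X (end₂ e) ∨ lookup Y (end₂ e))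
  χ-∪ X Y = χ-pointwise (X ∪ Y) X Y _∨_ λ v → lookup-zipWith _∨_ v X Y

  χ-─ : ∀ X Y e → χ (X ─ Y) e ≡ crossing (lookup X (end₁ e) ∧ not (lookup Y (end₁ e))) (lookup X (end₂ e) ∧ not (lookup Y (end₂ e)))
  χ-─ X Y = χ-pointwise (X ─ Y) X Y (λ a b → a ∧ not b) (lookup-─ X Y)

  δ-+-mono-≤ : ∀ A B C D → (∀ e → χ A e + χ B e ≤ χ C e + χ D e) →
    ∣ δ H A ∣ + ∣ δ H B ∣ ≤ ∣ δ H C ∣ + ∣ δ H D ∣
  δ-+-mono-≤ A B C D le =
    subst₂ _≤_ (sym (cong₂ _+_ (∣δ∣≡∑χ A) (∣δ∣≡∑χ B))) (sym (cong₂ _+_ (∣δ∣≡∑χ C) (∣δ∣≡∑χ D)))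
      (sum-+-mono-≤ le)

  δ-submodular : ∀ X Y → ∣ δ H (X ∩ Y) ∣ + ∣ δ H (X ∪ Y) ∣ ≤ ∣ δ H X ∣ + ∣ δ H Y ∣
  δ-submodular X Y = δ-+-mono-≤ (X ∩ Y) (X ∪ Y) X Y edgewise
    where
    open Data.Nat.Properties.≤-Reasoning
    edgewise : ∀ e → χ (X ∩ Y) e + χ (X ∪ Y) e ≤ χ X e + χ Y e
    edgewise e = begin
      χ (X ∩ Y) e + χ (X ∪ Y) e ≡⟨ cong₂ _+_ (χ-∩ X Y e) (χ-∪ X Y e) ⟩
      _                         ≤⟨ crossing-submodular (lookup X (end₁ e)) (lookup X (end₂ e)) (lookup Y (end₁ e)) (lookup Y (end₂ e)) ⟩
      χ X e + χ Y e             ∎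

  δ-posimodular : ∀ X Y → ∣ δ H (Y ─ X) ∣ + ∣ δ H (X ─ Y) ∣ ≤ ∣ δ H X ∣ + ∣ δ H Y ∣
  δ-posimodular X Y = δ-+-mono-≤ (Y ─ X) (X ─ Y) X Y edgewise
    where
    open Data.Nat.Properties.≤-Reasoning
    edgewise : ∀ e → χ (Y ─ X) e + χ (X ─ Y) e ≤ χ X e + χ Y e
    edgewise e = begin
      χ (Y ─ X) e + χ (X ─ Y) e ≡⟨ cong₂ _+_ (χ-─ Y X e) (χ-─ X Y e) ⟩
      _                         ≤⟨ crossing-posimodular (lookup X (end₁ e)) (lookup X (end₂ e)) (lookup Y (end₁ e)) (lookup Y (end₂ e)) ⟩
      χ X e + χ Y e             ∎

  δ-split : ∀ X Y → ∣ δ H (X ∩ Y) ∣ + ∣ δ H (Y ─ X) ∣ ≡ ∣ δ H Y ∣ + (sum (χ-inside X Y) + sum (χ-inside X Y))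
  δ-split X Y = begin
    ∣ δ H (X ∩ Y) ∣ + ∣ δ H (Y ─ X) ∣              ≡⟨ cong₂ _+_ (∣δ∣≡∑χ (X ∩ Y)) (∣δ∣≡∑χ (Y ─ X)) ⟩
    sum (χ (X ∩ Y)) + sum (χ (Y ─ X))             ≡⟨ ∑-distrib-+ (χ (X ∩ Y)) (χ (Y ─ X)) ⟨
    sum (λ e → χ (X ∩ Y) e + χ (Y ─ X) e)         ≡⟨ sum-cong-≗ edgewise ⟩
    sum (λ e → χ Y e + (g e + g e))               ≡⟨ ∑-distrib-+ (χ Y) (λ e → g e + g e) ⟩
    sum (χ Y) + sum (λ e → g e + g e)             ≡⟨ cong₂ _+_ (sym (∣δ∣≡∑χ Y)) (∑-distrib-+ g g) ⟩
    ∣ δ H Y ∣ + (sum g + sum g)                   ∎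
    where
    open ≡-Reasoning
    g : E H → ℕ
    g = χ-inside X Y
    edgewise : ∀ e → χ (X ∩ Y) e + χ (Y ─ X) e ≡ χ Y e + (g e + g e)
    edgewise e = trans (cong₂ _+_ (χ-∩ X Y e) (χ-─ Y X e)) (crossing-split (lookup X (end₁ e)) (lookup X (end₂ e)) (lookup Y (end₁ e)) (lookup Y (end₂ e)))

  δ-∁ : ∀ X → ∣ δ H (∁ X) ∣ ≡ ∣ δ H X ∣
  δ-∁ X = trans (∣δ∣≡∑χ (∁ X)) (trans (sum-cong-≗ edgewise) (sym (∣δ∣≡∑χ X)))
    where
    edgewise : ∀ e → χ (∁ X) e ≡ χ X e
    edgewise e = trans (cong₂ crossing (lookup-map (end₁ e) not X) (lookup-map (end₂ e) not X))
                       (crossing-complement (lookup X (end₁ e)) (lookup X (end₂ e)))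

  ∁-nontrivialThreeCut : ∀ X → NontrivialThreeCut H X → NontrivialThreeCut H (∁ X)
  ∁-nontrivialThreeCut X (((X≠∅ , ∁X≠∅) , 2≤∣X∣ , 2≤∣∁X∣) , ∣δX∣≡3) =
    ((∁X≠∅ , subst Nonempty (sym (∁-involutive X)) X≠∅) ,
     2≤∣∁X∣ , subst (λ Z → 2 ≤ ∣ Z ∣) (sym (∁-involutive X)) 2≤∣X∣) ,
    trans (δ-∁ X) ∣δX∣≡3

δ-deleteEdge : ∀ {n k} (ends : Fin (suc k) → Fin n × Fin n) (e : Fin (suc k)) (X : Subset n) →
  let H = graph n (suc k) ends in
  ∣ δ H X ∣ ≡ χ H X e + ∣ δ (deleteEdge H e) X ∣
δ-deleteEdge {n} {k} ends e X = begin
  ∣ δ H X ∣                   ≡⟨ ∣δ∣≡∑χ H X ⟩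
  sum (χ H X)                 ≡⟨ sum-remove (χ H X) ⟩
  χ H X e + sum (χ H∖e X)     ≡⟨ cong (χ H X e +_) (∣δ∣≡∑χ H∖e X) ⟨
  χ H X e + ∣ δ H∖e X ∣       ∎
  where
  open ≡-Reasoning
  H H∖e : Graph
  H = graph n (suc k) ends
  H∖e = deleteEdge H e

small-cut-after-deletion : ∀ {n k} (ends : Fin (suc k) → Fin n × Fin n) (e : Fin (suc k)) →
  let H = graph n (suc k) ends in
  ThreeEdgeConnected H → ∀ X → IsCutSide H X → ∣ δ (deleteEdge H e) X ∣ < 3 →
  crosses H X e ≡ true × ∣ δ H X ∣ ≡ 3
small-cut-after-deletion {n} {k} ends e conn X side small
  with crosses (graph n (suc k) ends) X e | δ-deleteEdge ends e X
... | false | δ≡ = ⊥-elim (<⇒≱ (subst (_< 3) (sym δ≡) small) (conn X side))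
... | true  | δ≡ = refl , ≤-antisym (subst (_≤ 3) (sym δ≡) small) (conn X side)

crossing-ends : ∀ H X e → crosses H X e ≡ true →
  (end₁ H e ∈ X × end₂ H e ∉ X) ⊎ (end₂ H e ∈ X × end₁ H e ∉ X)
crossing-ends H X e crosses≡true with xor-true crosses≡true
... | inj₁ (in₁ , out₂) = inj₁ (lookup⇒[]= _ X in₁ , ∉-lookup out₂)
... | inj₂ (out₁ , in₂) = inj₂ (lookup⇒[]= _ X in₂ , ∉-lookup out₁)

tight : ∀ {p q} → 3 ≤ p → 3 ≤ q → p + q ≤ 3 + 3 → p ≡ 3
tight {p} {q} 3≤p 3≤q p+q≤6 = ≤-antisym (+-cancelʳ-≤ q p 3 (≤-trans p+q≤6 (+-monoʳ-≤ 3 3≤q))) 3≤p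

3≢double : ∀ g → 3 ≢ g + g
3≢double zero ()
3≢double (suc zero) ()
3≢double (suc (suc g)) 3≡ with suc-injective (suc-injective 3≡)
... | 1≡ with suc-injective (trans 1≡ (+-suc g (suc g)))
... | 0≡ with trans 0≡ (+-suc g g)
... | ()

module _ (H : Graph) (conn : ThreeEdgeConnected H) (Y : VSet H)
         (minY : InclusionMinimal H (NontrivialThreeCut H) Y) where

  cut≥3 : ∀ {Z a b} → a ∈ Z → b ∉ Z → 3 ≤ ∣ δ H Z ∣
  cut≥3 a∈Z b∉Z = conn _ ((_ , a∈Z) , (_ , x∉p⇒x∈∁p b∉Z))

  -- X and Y cross with all four corners X∩Y ∋ a, Y─X ∋ b, X─Y ∋ c, outside ∋ d:
  -- then X∩Y and Y─X are 3-cuts by sub- and posimodularity, against parity.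
  no-four-corners : ∀ X → ∣ δ H X ∣ ≡ 3 → ∀ {a b c d} →
    a ∈ X → a ∈ Y → b ∉ X → b ∈ Y → c ∈ X → c ∉ Y → d ∉ X → d ∉ Y → ⊥
  no-four-corners X ∣δX∣≡3 a∈X a∈Y b∉X b∈Y c∈X c∉Y d∉X d∉Y =
    3≢double G (+-cancelˡ-≡ 3 _ _ parity)
    where
    open ≡-Reasoning
    G : ℕ
    G = sum (χ-inside H X Y)
    ∣δY∣≡3 : ∣ δ H Y ∣ ≡ 3
    ∣δY∣≡3 = proj₂ (proj₁ minY)
    ≤6 : ∣ δ H X ∣ + ∣ δ H Y ∣ ≤ 3 + 3
    ≤6 = ≤-reflexive (cong₂ _+_ ∣δX∣≡3 ∣δY∣≡3)
    ∣δ[X∩Y]∣≡3 : ∣ δ H (X ∩ Y) ∣ ≡ 3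
    ∣δ[X∩Y]∣≡3 = tight
      (cut≥3 (x∈p∩q⁺ (a∈X , a∈Y)) (c∉Y ∘ proj₂ ∘ x∈p∩q⁻ X Y))
      (cut≥3 (x∈p∪q⁺ (inj₁ a∈X)) ([ d∉X , d∉Y ] ∘ x∈p∪q⁻ X Y))
      (≤-trans (δ-submodular H X Y) ≤6)
    ∣δ[Y─X]∣≡3 : ∣ δ H (Y ─ X) ∣ ≡ 3
    ∣δ[Y─X]∣≡3 = tight
      (cut≥3 (x∈p∧x∉q⇒x∈p─q b∈Y b∉X) (d∉Y ∘ p─q⊆p Y X))
      (cut≥3 (x∈p∧x∉q⇒x∈p─q c∈X c∉Y) (d∉X ∘ p─q⊆p X Y))
      (≤-trans (δ-posimodular H X Y) ≤6)
    parity : 3 + 3 ≡ 3 + (G + G)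
    parity = begin
      3 + 3                              ≡⟨ cong₂ _+_ ∣δ[X∩Y]∣≡3 ∣δ[Y─X]∣≡3 ⟨
      ∣ δ H (X ∩ Y) ∣ + ∣ δ H (Y ─ X) ∣  ≡⟨ δ-split H X Y ⟩
      ∣ δ H Y ∣ + (G + G)                ≡⟨ cong (_+ (G + G)) ∣δY∣≡3 ⟩
      3 + (G + G)                        ∎

  -- No nontrivial 3-cut crosses the minimal one: if X ⊆ Y or ∁X ⊆ Y, that set
  -- is a smaller nontrivial 3-cut inside Y; otherwise all four corners occur.
  no-crossing : ∀ X → NontrivialThreeCut H X → ∀ {a b} → a ∈ X → a ∈ Y → b ∉ X → b ∈ Y → ⊥
  no-crossing X X-cut {a} {b} a∈X a∈Y b∉X b∈Y with ⊆-or-counterexample (∁ X) Y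
  ... | inj₁ ∁X⊆Y =
    proj₂ minY (∁ X) (∁X⊆Y , a , a∈Y , x∈p⇒x∉∁p a∈X) (∁-nontrivialThreeCut H X X-cut)
  ... | inj₂ (d , d∈∁X , d∉Y) with ⊆-or-counterexample X Y
  ...   | inj₁ X⊆Y = proj₂ minY X (X⊆Y , b , b∈Y , b∉X) X-cut
  ...   | inj₂ (c , c∈X , c∉Y) =
    no-four-corners X (proj₂ X-cut) a∈X a∈Y b∉X b∈Y c∈X c∉Y (x∈∁p⇒x∉p d∈∁X) d∉Y

-- The theorem: a cut of H∖e with fewer than three edges whose sides both have
-- at least two vertices would be a nontrivial 3-cut of H separating the two
-- ends of e, which lie in Y.
mainTheorem12 : (H : Graph) → ThreeEdgeConnected H →
    (Y : VSet H) → InclusionMinimal H (NontrivialThreeCut H) Y →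
    (e : E H) → EdgeOfInduced H Y e →
    InternallyThreeEdgeConnected (deleteEdge H e)
mainTheorem12 (graph n zero ends) conn Y minY ()
mainTheorem12 H@(graph n (suc k) ends) conn Y minY e (end₁∈Y , end₂∈Y) X side small
  with ∣ X ∣ ≟ 1 | ∣ ∁ X ∣ ≟ 1
... | yes ∣X∣≡1 | _ = inj₁ ∣X∣≡1
... | no _ | yes ∣∁X∣≡1 = inj₂ ∣∁X∣≡1
... | no ∣X∣≢1 | no ∣∁X∣≢1 =
  ⊥-elim ([ separates end₁∈Y end₂∈Y , separates end₂∈Y end₁∈Y ] (crossing-ends H X e e-crosses))
  where
  cut-in-H : crosses H X e ≡ true × ∣ δ H X ∣ ≡ 3
  cut-in-H = small-cut-after-deletion ends e conn X side small
  e-crosses : crosses H X e ≡ true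
  e-crosses = proj₁ cut-in-H
  X-cut : NontrivialThreeCut H X
  X-cut = (side , 2≤∣p∣ (proj₁ side) ∣X∣≢1 , 2≤∣p∣ (proj₂ side) ∣∁X∣≢1) , proj₂ cut-in-H
  separates : ∀ {u w} → u ∈ Y → w ∈ Y → u ∈ X × w ∉ X → ⊥
  separates u∈Y w∈Y (u∈X , w∉X) = no-crossing H conn Y minY X X-cut u∈X u∈Y w∉X w∈Y
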